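{- Let $g$ be a global state, $p,q\in\mathcal{PV}$ and $\Gamma\subseteq\mathcal{A}$. If $\phi\in\{p,\ p\wedge q,\ \langle\langle\Gamma\rangle\rangle \mathrm{X}\, p,\ \langle\langle\Gamma\rangle\rangle \mathrm{G}\, p,\ \langle\langle\Gamma\rangle\rangle\, p\,\mathrm{U}\, q\}$, then the predicate $Model_{g,\phi}(\mathcal{V}_M)$ is positive monotonic with respect to the variables $VB$.
   Context: Fix a set of agents $\mathcal{A}=\{1,\dots,n\}$, a finite set $\mathcal{PV}$ of propositional variables, and for each agent $i$ a finite set of local states $L_i=\{l_i^1,\dots,l_i^{n_i}\}$. Agent $i$ has actions $Act_i=\{a_i^1,\dots,a_i^{n_i}\}$ and a local protocol $P_i:L_i\to 2^{Act_i}$ with $P_i(l)\neq\emptyset$ for all $l\in L_i$; its local transition function is $T_i(l_i^k,a_i^j)=l_i^j$, defined iff $a_i^j\in P_i(l_i^k)$. A model is $M=(St,T,V)$ with global states $St=L_1\times\dots\times L_n$, global actions $Act=Act_1\times\dots\times Act_n$, global transition function $T(g,a)=g'$ iff $T_i(g^i,a^i)=g'^i$ for all $i$ (where $g^i$, $a^i$ denote the $i$-th components), and valuation $V:St\to 2^{\mathcal{PV}}$. Encoding: $P_i$ is represented by a Boolean table of $n_i\times n_i$ entries (entry $(l,a)$ is $1$ iff $a\in P_i(l)$), flattened into a bit vector $tb_i$; $V$ is represented by a bit vector $vb$ of length $|St|\cdot|\mathcal{PV}|$ (entry $(g,p)$ is $1$ iff $p\in V(g)$). The model is encoded by $v_M=(tb_1,\dots,tb_n,vb)$,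 and $\mathcal{V}_M=(TB_1,\dots,TB_n,VB)$ denotes the corresponding vector of Boolean variables; only bit vectors encoding models (each local state has at least one available action) are considered. A path from $g$ is an infinite sequence $g_0a_0g_1a_1\dots$ with $g_0=g$ and $T(g_k,a_k)=g_{k+1}$ for all $k$; $\pi[k]=g_k$. A (memoryless perfect information) strategy of agent $i$ is a function $\sigma_i:St\to Act_i$ with $\sigma_i(g)\in P_i(g^i)$; a joint strategy $\sigma_\Gamma$ for $\Gamma\subseteq\mathcal{A}$ is a tuple of strategies of the agents in $\Gamma$. The outcome $out_M(g,\sigma_\Gamma)$ is the set of paths $g_0a_0g_1\dots$ from $g$ with $a_k^j=\sigma_j(g_k)$ for all $k$ and all $j\in\Gamma$. ATL formulae: $\varphi::=p\mid\neg\varphi\mid\varphi\wedge\varphi\mid\langle\langle\Gamma\rangle\rangle\mathrm{X}\varphi\mid\langle\langle\Gamma\rangle\rangle\varphi\mathrm{U}\varphi\mid\langle\langle\Gamma\rangle\rangle\mathrm{G}\varphi$. Semantics: $M,g\models p$ iff $p\in V(g)$; Boolean cases as usual; $M,g\models\langle\langle\Gamma\rangle\rangle\mathrm{X}\varphi$ iff there is $\sigma_\Gamma$ with $out_M(g,\sigma_\Gamma)\neq\emptyset$ and $M,\pi[1]\models\varphi$ for every $\pi\in out_M(g,\sigma_\Gamma)$; $M,g\models\langle\langle\Gamma\rangle\rangle\varphi_1\mathrm{U}\varphi_2$ iff there is $\sigma_\Gamma$ with nonempty outcome such that every $\pi$ in it has some $i\ge0$ with $M,\pi[i]\models\varphi_2$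 and $M,\pi[j]\models\varphi_1$ for all $j<i$; $M,g\models\langle\langle\Gamma\rangle\rangle\mathrm{G}\varphi$ iff there is $\sigma_\Gamma$ with nonempty outcome such that $M,\pi[i]\models\varphi$ for all $i\ge0$ and all $\pi$ in it. $Model_{g,\phi}(v_M)=1$ iff $M,g\models\phi$ for the model $M$ encoded by $v_M$. Monotonicity: a predicate on bit vectors is positive monotonic w.r.t. a set $W$ of its variables if changing any single variable of $W$ from $0$ to $1$ (others fixed) preserves the value $1$; it is negative monotonic w.r.t. $W$ if changing any single variable of $W$ from $1$ to $0$ preserves the value $1$. -}

module Defs where

open import Data.Nat using (ℕ; zero; suc)
open import Data.Fin using (Fin)
open import Data.Fin.Subset using (Subset; _∈_)
open import Data.Fin.Properties using (all?; _≟_)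
open import Data.Bool using (Bool; true; false; if_then_else_)
open import Data.Product using (Σ; ∃; _×_; _,_)
open import Data.Empty using (⊥)
open import Relation.Nullary using (¬_; Dec; yes; no)
open import Relation.Nullary.Decidable using (⌊_⌋; _×-dec_)
open import Relation.Binary.PropositionalEquality using (_≡_)

-- Fixed signature: n agents; agent i has ns i local states
-- l_i^0 .. l_i^(ns i - 1) and equally many actions a_i^j (a_i^j leads to l_i^j);
-- m propositional variables (PV = Fin m).

module _ {n : ℕ} (ns : Fin n → ℕ) where

  St : Set
  St = (i : Fin n) → Fin (ns i)

  Act : Set
  Act = (i : Fin n) → Fin (ns i)

  -- Boolean tables tb_i : entry (l , a) = true iff a ∈ P_i(l)
  ProtocolTables : Set
  ProtocolTables = (i : Fin n) → Fin (ns i) → Fin (ns i) → Bool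

  -- valuation bit vector vb : entry (g , p) = true iff p ∈ V(g)
  ValBits : ℕ → Set
  ValBits m = St → Fin m → Bool

  -- only encodings of models: every local state has an available action
  ValidTables : ProtocolTables → Set
  ValidTables tb = (i : Fin n) (l : Fin (ns i)) → ∃ λ a → tb i l a ≡ true

  Trans : ProtocolTables → St → Act → St → Set
  Trans tb g a g' = (i : Fin n) → (tb i (g i) (a i) ≡ true) × (g' i ≡ a i)

  record Path (tb : ProtocolTables) (g : St) : Set where
    field
      state  : ℕ → St
      action : ℕ → Act
      start  : state 0 ≡ g
      step   : (k : ℕ) → Trans tb (state k) (action k) (state (suc k))
  open Path public

  record JointStrategy (tb : ProtocolTables) (Γ : Subset n) : Set where
    field
      σ     : (i : Fin n) → i ∈ Γ → St → Fin (ns i)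
      legal : (i : Fin n) (i∈Γ : i ∈ Γ) (g : St) → tb i (g i) (σ i i∈Γ g) ≡ true
  open JointStrategy public

  InOutcome : {tb : ProtocolTables} {Γ : Subset n} {g : St} →
              JointStrategy tb Γ → Path tb g → Set
  InOutcome {Γ = Γ} s π =
    (k : ℕ) (j : Fin n) (j∈Γ : j ∈ Γ) → action π k j ≡ σ s j j∈Γ (state π k)

  data Form (m : ℕ) : Set where
    var  : Fin m → Form m
    neg  : Form m → Form m
    _∧′_ : Form m → Form m → Form m
    ⟪_⟫X_   : Subset n → Form m → Form m
    ⟪_⟫_U_  : Subset n → Form m → Form m → Form m
    ⟪_⟫G_   : Subset n → Form m → Form m

  Sat : {m : ℕ} → ProtocolTables → ValBits m → St → Form m → Set
  Sat tb vb g (var p) = vb g p ≡ true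
  Sat tb vb g (neg φ) = ¬ Sat tb vb g φ
  Sat tb vb g (φ ∧′ ψ) = Sat tb vb g φ × Sat tb vb g ψ
  Sat tb vb g (⟪ Γ ⟫X φ) =
    Σ (JointStrategy tb Γ) λ s →
      (Σ (Path tb g) λ π → InOutcome s π) ×
      ((π : Path tb g) → InOutcome s π → Sat tb vb (state π 1) φ)
  Sat tb vb g (⟪ Γ ⟫ φ U ψ) =
    Σ (JointStrategy tb Γ) λ s →
      (Σ (Path tb g) λ π → InOutcome s π) ×
      ((π : Path tb g) → InOutcome s π →
         ∃ λ i → Sat tb vb (state π i) ψ ×
                 ((j : ℕ) → j Data.Nat.< i → Sat tb vb (state π j) φ))
  Sat tb vb g (⟪ Γ ⟫G φ) =
    Σ (JointStrategy tb Γ) λ s →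
      (Σ (Path tb g) λ π → InOutcome s π) ×
      ((π : Path tb g) → InOutcome s π → (i : ℕ) → Sat tb vb (state π i) φ)

  Model : {m : ℕ} → St → Form m → ProtocolTables → ValBits m → Set
  Model g φ tb vb = Sat tb vb g φ

  _≟St_ : (g h : St) → Dec ((i : Fin n) → g i ≡ h i)
  g ≟St h = all? (λ i → g i ≟ h i)

  setBit : {m : ℕ} → ValBits m → St → Fin m → ValBits m
  setBit vb h r g p = if ⌊ (g ≟St h) ×-dec (p ≟ r) ⌋ then true else vb g p

  PosMonoVB : {m : ℕ} → (ProtocolTables → ValBits m → Set) → Set
  PosMonoVB {m} Pr =
    (tb : ProtocolTables) → ValidTables tb → (vb : ValBits m) →
    (h : St) (r : Fin m) → vb h r ≡ false →
    Pr tb vb → Pr tb (setBit vb h r)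

-- All five formulas are negation-free, and satisfaction of a negation-free ATL
-- formula only ever reads the valuation positively: the strategy and the
-- outcome paths witnessing a strategic modality depend on the protocol tables
-- alone, so raising valuation bits keeps every witness valid.
module Submission where

open import Defs
open import Data.Nat using (ℕ)
open import Data.Fin using (Fin)
open import Data.Fin.Subset using (Subset)
open import Data.Sum using (_⊎_; inj₁; inj₂)
open import Data.Product using (_,_)
open import Data.Bool using (true; false)
open import Data.Fin.Properties using (_≟_)
open import Relation.Nullary.Decidable using (⌊_⌋; _×-dec_)
open import Relation.Binary.PropositionalEquality using (_≡_; refl)

module _ {n : ℕ} (ns : Fin n → ℕ) {m : ℕ} where

  _⊆ᵛ_ : ValBits ns m → ValBits ns m → Set
  vb ⊆ᵛ vb′ = ∀ g p → vb g p ≡ true → vb′ g p ≡ true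

  ⊆ᵛ-setBit : (vb : ValBits ns m) (h : St ns) (r : Fin m) → vb ⊆ᵛ setBit ns vb h r
  ⊆ᵛ-setBit vb h r g p vb[g,p] with ⌊ (_≟St_ ns g h) ×-dec (p ≟ r) ⌋
  ... | true  = refl
  ... | false = vb[g,p]

  data NegationFree : Form ns m → Set where
    var  : ∀ p → NegationFree (var p)
    _∧′_ : ∀ {φ ψ} → NegationFree φ → NegationFree ψ → NegationFree (φ ∧′ ψ)
    ⟪_⟫X_  : ∀ Γ {φ} → NegationFree φ → NegationFree (⟪ Γ ⟫X φ)
    ⟪_⟫_U_ : ∀ Γ {φ ψ} → NegationFree φ → NegationFree ψ → NegationFree (⟪ Γ ⟫ φ U ψ)
    ⟪_⟫G_  : ∀ Γ {φ} → NegationFree φ → NegationFree (⟪ Γ ⟫G φ)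

  Sat-mono : ∀ {tb vb vb′ φ} → NegationFree φ → vb ⊆ᵛ vb′ →
             ∀ g → Sat ns tb vb g φ → Sat ns tb vb′ g φ
  Sat-mono (var p) vb⊆vb′ g = vb⊆vb′ g p
  Sat-mono (φ ∧′ ψ) vb⊆vb′ g (g⊨φ , g⊨ψ) = Sat-mono φ vb⊆vb′ g g⊨φ , Sat-mono ψ vb⊆vb′ g g⊨ψ
  Sat-mono (⟪ Γ ⟫X φ) vb⊆vb′ g (s , nonempty , next) =
    s , nonempty , λ π π∈out → Sat-mono φ vb⊆vb′ _ (next π π∈out)
  Sat-mono (⟪ Γ ⟫ φ U ψ) vb⊆vb′ g (s , nonempty , until) =
    s , nonempty , λ π π∈out → let (i , πi⊨ψ , before) = until π π∈out in
      i , Sat-mono ψ vb⊆vb′ _ πi⊨ψ , λ j j<i → Sat-mono φ vb⊆vb′ _ (before j j<i)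
  Sat-mono (⟪ Γ ⟫G φ) vb⊆vb′ g (s , nonempty , always) =
    s , nonempty , λ π π∈out i → Sat-mono φ vb⊆vb′ _ (always π π∈out i)

  negationFree⇒posMonoVB : ∀ {φ} → NegationFree φ → ∀ g → PosMonoVB ns (Model ns g φ)
  negationFree⇒posMonoVB φ g tb _ vb h r _ = Sat-mono φ (⊆ᵛ-setBit vb h r) g

theorem3p3 : {n : ℕ} (ns : Fin n → ℕ) {m : ℕ} (g : St ns) (p q : Fin m) (Γ : Subset n) (φ : Form ns m) →
    (φ ≡ var p) ⊎ (φ ≡ (var p ∧′ var q)) ⊎ (φ ≡ (⟪ Γ ⟫X var p)) ⊎ (φ ≡ (⟪ Γ ⟫G var p)) ⊎ (φ ≡ (⟪ Γ ⟫ var p U var q)) →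
    PosMonoVB ns (Model ns g φ)
theorem3p3 ns g p q Γ φ φ∈forms = negationFree⇒posMonoVB ns (negationFree φ∈forms) g
  where
  negationFree : ∀ {φ} → (φ ≡ var p) ⊎ (φ ≡ (var p ∧′ var q)) ⊎ (φ ≡ (⟪ Γ ⟫X var p)) ⊎
                 (φ ≡ (⟪ Γ ⟫G var p)) ⊎ (φ ≡ (⟪ Γ ⟫ var p U var q)) → NegationFree ns φ
  negationFree (inj₁ refl)                          = var p
  negationFree (inj₂ (inj₁ refl))                   = var p ∧′ var q
  negationFree (inj₂ (inj₂ (inj₁ refl)))            = ⟪ Γ ⟫X var p
  negationFree (inj₂ (inj₂ (inj₂ (inj₁ refl))))     = ⟪ Γ ⟫G var p
  negationFree (inj₂ (inj₂ (inj₂ (inj₂ refl))))     = ⟪ Γ ⟫ var p U var q
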